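{- Assume $\Lambda$ admits one-step wsi models, and fix for each conjunctive one-step $\Lambda$-formula $\psi$ over a finite set $V$ a one-step wsi model $(X_\psi,\tau_\psi,t_\psi)$ with $X_\psi\subseteq\mathcal P(V(\psi))$ and $\tau_\psi(p)=\{A\in X_\psi: p\in A\}$ for $p\in V(\psi)$, where $V(\psi)$ is the set of variables occurring in $\psi$. Let $\phi=\nu(x_0;x_1,\dots,x_n).(\phi_0;\phi_1,\dots,\phi_n)$ be a shallow conjunctive $\Lambda$-$\nu$-sentence, i.e. each $\phi_i$ is a conjunctive one-step $\Lambda$-formula over $V=\{x_0,\dots,x_n\}$ (a finite conjunction of atoms $\heartsuit x_j$, $\heartsuit\in\Lambda$). For $A\subseteq V$ let $\phi_A=\bigwedge_{x_i\in A}\phi_i$. Let $X_\phi$ be the smallest subset of $\mathcal P(V)$ containing $r_\phi=\{x_0\}$ such that $X_{\phi_A}\subseteq X_\phi$ for each $A\in X_\phi$, and define $\xi_\phi:X_\phi\to TX_\phi$ by $\xi_\phi(A)=T(i_A)(t_{\phi_A})$, where $i_A:X_{\phi_A}\hookrightarrow X_\phi$ is the inclusion. Then $((X_\phi,\xi_\phi),r_\phi)$ is a wsi model for $\phi$.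
   Context: Fix an endofunctor $T$ on sets, non-trivial ($TX=\emptyset\Rightarrow X=\emptyset$) and preserving subsets. $\Lambda$ is a set of modal operators $\heartsuit$ (unary; atomic propositions nullary), each with a monotone natural predicate lifting $[\![\heartsuit]\!]_X:\mathcal P(X)\to\mathcal P(TX)$ (naturality: $[\![\heartsuit]\!]_X(f^{ -1}[A])=(Tf)^{ -1}[[\![\heartsuit]\!]_Y(A)]$); $t\models\heartsuit A$ means $t\in[\![\heartsuit]\!]_X(A)$. Models are $T$-coalgebras $(X,\xi)$. A $\Lambda$-simulation of $C=(X,\xi)$ by $D=(Y,\zeta)$ is $S\subseteq X\times Y$ with: $xSy$ and $\xi(x)\models\heartsuit A$ imply $\zeta(y)\models\heartsuit S[A]$. Fixpoint formulas: over a set $\Delta$ of fixpoint variables, positive $\Lambda$-$\nu$-formulas are built from $\top,\bot,\wedge,\vee,\heartsuit$, variables and $\alpha(y_0;y_1,\dots,y_n).(\phi_0;\dots,\phi_n)$ ($\alpha\in\{\nu,\mu\}$, distinct $y_i$); conjunctive $\Lambda$-$\nu$-formulas use only $\top,\wedge,\heartsuit$, variables and $\nu$; a sentence has no free fixpoint variables. $[\![\nu(y_0;\dots,y_n).(\phi_0;\dots,\phi_n)]\!]_{C,\mathcal V}$ is the first component of the greatest fixpoint of $(A_0,\dots,A_n)\mapsto([\![\phi_i]\!]_{C,\mathcal V[y_0\mapsto A_0,\dots,y_n\mapsto A_n]})_{i=0..n}$ ($\mu$ dually), variables are interpreted by $\mathcal V$, and $x\in[\![\heartsuit\phi]\!]$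 iff $\xi(x)\models\heartsuit[\![\phi]\!]$. A pointed model $(C_\phi,r)$ is wsi for a sentence $\phi$ if for every pointed model $(D,y)$: $y\models_D\phi$ iff $rSy$ for some $\Lambda$-simulation $S$ of $C_\phi$ by $D$. One-step notions: a one-step model over $V$ is $(X,\tau,t)$, $\tau:V\to\mathcal P(X)$, $t\in TX$, $\breve\tau(x)=\{p:x\in\tau(p)\}$; $(X,\tau,t)\models\bigwedge\heartsuit_ip_i$ iff $t\models\heartsuit_i\tau(p_i)$ for all $i$. $(X,\tau,t)$ is one-step wsi for a conjunctive one-step formula $\psi$ if it satisfies $\psi$ and for every one-step model $(Y,\theta,s)\models\psi$, $A\subseteq X$, $\heartsuit\in\Lambda$: $t\models\heartsuit A$ implies $s\models\heartsuit S[A]$, where $xSy$ iff $\breve\tau(x)\subseteq\breve\theta(y)$. $\Lambda$ admits one-step wsi models if every conjunctive one-step formula has one. -}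

module Defs where

open import Level using (Level; _⊔_)
open import Data.Empty using (⊥)
open import Data.Product using (Σ; ∃; _×_; _,_; proj₁; proj₂)
open import Data.List using (List; []; _∷_; _++_)
open import Data.List.Relation.Unary.All using (All)
open import Data.List.Relation.Unary.Any using (Any)
open import Data.Fin using (Fin; zero; suc)
open import Data.Fin.Subset using (Subset; _∈_; ⁅_⁆)
open import Data.Vec using ([]; _∷_)
open import Data.Bool using (true; false)
open import Data.Nat using (ℕ; suc)
open import Function using (_∘_; id)
open import Function.Definitions using (Injective)
open import Relation.Binary.PropositionalEquality using (_≡_)
open import Data.Irrelevant using (Irrelevant; [_])

_⇔_ : ∀ {a b} → Set a → Set b → Set (a ⊔ b)
A ⇔ B = (A → B) × (B → A)

-- The standing setting: a set functor T (non-trivial, preserving subsets,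
-- i.e. injections) and a similarity type Λ = nullary atoms + unary
-- modalities, each with a monotone natural predicate lifting.
-- Subsets of a set X are predicates X → Set.

record Setting : Set₁ where
  field
    T      : Set → Set
    fmap   : ∀ {X Y : Set} → (X → Y) → T X → T Y
    fmap-id   : ∀ {X : Set} (t : T X) → fmap id t ≡ t
    fmap-∘    : ∀ {X Y Z : Set} (f : X → Y) (g : Y → Z) (t : T X) →
                fmap (g ∘ f) t ≡ fmap g (fmap f t)
    fmap-cong : ∀ {X Y : Set} {f g : X → Y} → (∀ x → f x ≡ g x) →
                (t : T X) → fmap f t ≡ fmap g t
    nontrivial : ∀ {X : Set} → (T X → ⊥) → (X → ⊥)
    preserves-inj : ∀ {X Y : Set} (f : X → Y) →
                    Injective _≡_ _≡_ f → Injective _≡_ _≡_ (fmap f)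
    Atom : Set
    Mod  : Set
    ⟦_⟧ₐ : Atom → ∀ {X : Set} → T X → Set
    ⟦_⟧ₘ : Mod → ∀ {X : Set} → (X → Set) → T X → Set
    natₐ : ∀ (p : Atom) {X Y : Set} (f : X → Y) (t : T X) →
           ⟦ p ⟧ₐ t ⇔ ⟦ p ⟧ₐ (fmap f t)
    natₘ : ∀ (♥ : Mod) {X Y : Set} (f : X → Y) (A : Y → Set) (t : T X) →
           ⟦ ♥ ⟧ₘ (A ∘ f) t ⇔ ⟦ ♥ ⟧ₘ A (fmap f t)
    monoₘ : ∀ (♥ : Mod) {X : Set} {A B : X → Set} →
            (∀ x → A x → B x) → (t : T X) → ⟦ ♥ ⟧ₘ A t → ⟦ ♥ ⟧ₘ B t

image : {X Y : Set} → (X → Y → Set) → (X → Set) → Y → Set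
image {X} S A y = Σ X λ x → A x × S x y

-- subset of a finite powerset, as a genuine subtype (proof-irrelevant membership)
SubCar : ∀ {m} → (Subset m → Set) → Set
SubCar {m} P = Σ (Subset m) (λ A → Irrelevant (P A))

module _ (𝕊 : Setting) where
  open Setting 𝕊

  data Conj (V : Set) : Set where
    atom : Atom → Conj V
    box  : Mod → V → Conj V

  OneStepFormula : Set → Set
  OneStepFormula V = List (Conj V)

  record OneStepModel (V : Set) : Set₁ where
    constructor osm
    field
      Car : Set
      τ   : V → Car → Set
      pt  : T Car

  open OneStepModel

  holds₁ : ∀ {V} → OneStepModel V → Conj V → Set
  holds₁ M (atom p)  = ⟦ p ⟧ₐ (pt M)
  holds₁ M (box ♥ v) = ⟦ ♥ ⟧ₘ (τ M v) (pt M)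

  _⊨₁_ : ∀ {V} → OneStepModel V → OneStepFormula V → Set
  M ⊨₁ ψ = All (holds₁ M) ψ

  oneStepRel : ∀ {V} (M N : OneStepModel V) → Car M → Car N → Set
  oneStepRel {V} M N x y = ∀ (v : V) → τ M v x → τ N v y

  IsOneStepWSI : ∀ {V} → OneStepFormula V → OneStepModel V → Set₁
  IsOneStepWSI {V} ψ M =
    M ⊨₁ ψ ×
    (∀ (N : OneStepModel V) → N ⊨₁ ψ →
       (∀ (p : Atom) → ⟦ p ⟧ₐ (pt M) → ⟦ p ⟧ₐ (pt N)) ×
       (∀ (♥ : Mod) (A : Car M → Set) →
          ⟦ ♥ ⟧ₘ A (pt M) → ⟦ ♥ ⟧ₘ (image (oneStepRel M N) A) (pt N)))

  AdmitsOneStepWSI : Set₁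
  AdmitsOneStepWSI =
    ∀ (V : Set) (ψ : OneStepFormula V) → Σ (OneStepModel V) (IsOneStepWSI ψ)

  BoxAt : ∀ {V} → V → Conj V → Set
  BoxAt v (atom p)  = ⊥
  BoxAt v (box ♥ w) = v ≡ w

  Occurs : ∀ {V} → V → OneStepFormula V → Set
  Occurs v ψ = Any (BoxAt v) ψ

  record Coalg : Set₁ where
    constructor coalg
    field
      St : Set
      ξ  : St → T St

  open Coalg

  IsSimulation : (C D : Coalg) → (St C → St D → Set) → Set₁
  IsSimulation C D S =
    (∀ x y → S x y → ∀ (p : Atom) → ⟦ p ⟧ₐ (ξ C x) → ⟦ p ⟧ₐ (ξ D y)) ×
    (∀ x y → S x y → ∀ (♥ : Mod) (A : St C → Set) →
       ⟦ ♥ ⟧ₘ A (ξ C x) → ⟦ ♥ ⟧ₘ (image S A) (ξ D y))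

  -- A shallow conjunctive ν-sentence ν(x₀;x₁,…,xₙ).(φ₀;…;φₙ) is given by
  -- n and φs : Fin (suc n) → one-step formulas over {x₀,…,xₙ} = Fin (suc n).
  ShallowBody : ℕ → Set
  ShallowBody n = Fin (suc n) → OneStepFormula (Fin (suc n))

  -- semantics: y ⊨ φ iff y lies in the first component of the greatest
  -- fixpoint of U ↦ (⟦φᵢ⟧_{U})ᵢ, i.e. (Knaster–Tarski) in the first
  -- component of some post-fixpoint.
  ⟦_⟧ᶜ_ : ∀ {V} → OneStepFormula V → (D : Coalg) → (V → St D → Set) →
          St D → Set
  (⟦ ψ ⟧ᶜ D) U y = osm (St D) U (ξ D y) ⊨₁ ψ

  Sat : ∀ {n} → (D : Coalg) → St D → ShallowBody n → Set₁
  Sat {n} D y φs =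
    Σ (Fin (suc n) → St D → Set) λ U →
      (∀ i z → U i z → (⟦ φs i ⟧ᶜ D) U z) × U zero y

  IsWSI : ∀ {n} (C : Coalg) → St C → ShallowBody n → Set₁
  IsWSI C r φs =
    ∀ (D : Coalg) (y : St D) →
      Sat D y φs ⇔ Σ (St C → St D → Set) (λ S → IsSimulation C D S × S r y)

  record WSIFamily : Set₁ where
    field
      Xψ : (m : ℕ) → OneStepFormula (Fin m) → Subset m → Set
      tψ : (m : ℕ) (ψ : OneStepFormula (Fin m)) → T (SubCar (Xψ m ψ))
      Xψ⊆𝒫Vψ : ∀ m ψ (A : Subset m) → Xψ m ψ A → ∀ j → j ∈ A → Occurs j ψ
      isWSI : ∀ m ψ →
        IsOneStepWSI ψ (osm (SubCar (Xψ m ψ)) (λ p a → p ∈ proj₁ a) (tψ m ψ))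

  conjSub : ∀ {k} {C : Set} → (Fin k → List C) → Subset k → List C
  conjSub f []          = []
  conjSub f (true ∷ A)  = f zero ++ conjSub (f ∘ suc) A
  conjSub f (false ∷ A) = conjSub (f ∘ suc) A

  module Construction (W : WSIFamily) {n : ℕ} (φs : ShallowBody n) where
    open WSIFamily W

    φ[_] : Subset (suc n) → OneStepFormula (Fin (suc n))
    φ[ A ] = conjSub φs A

    data InXφ : Subset (suc n) → Set where
      root : InXφ ⁅ zero ⁆
      step : ∀ {A B} → InXφ A → Xψ (suc n) φ[ A ] B → InXφ B

    Xφ : Set
    Xφ = SubCar InXφ

    rφ : Xφ
    rφ = ⁅ zero ⁆ , [ root ]

    incl : (a : Xφ) → SubCar (Xψ (suc n) φ[ proj₁ a ]) → Xφ
    incl (A , [ ra ]) (B , [ xb ]) = B , [ step ra xb ]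

    ξφ : Xφ → T Xφ
    ξφ a = fmap (incl a) (tψ (suc n) φ[ proj₁ a ])

    Cφ : Coalg
    Cφ = coalg Xφ ξφ

{-# OPTIONS --safe #-}
module Submission where

-- A post-fixpoint U of the body gives the simulation "A S y iff y ∈ Uⱼ for
-- all xⱼ ∈ A": y then satisfies φ_A one-step, so one-step wsi of t_{φ_A}
-- yields the simulation clause at A, which naturality carries along i_A.
-- Conversely a simulation S gives the post-fixpoint Uⱼ = S[{A ∣ xⱼ ∈ A}]:
-- t_{φ_A} satisfies φ_A, and S carries this to every state S-related to A.

open import Defs
open import Data.Nat using (ℕ; suc)
open import Data.Fin using (Fin; zero; suc)
open import Data.Fin.Subset using (Subset; _∈_)
open import Data.Fin.Subset.Properties using (x∈⁅x⁆; x∈⁅y⁆⇒x≡y)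
open import Data.Vec using ([]; _∷_; here; there)
open import Data.Bool using (true; false)
open import Data.List using (List)
open import Data.List.Relation.Unary.All as All using (All; [])
open import Data.List.Relation.Unary.All.Properties using (++⁺; ++⁻ˡ; ++⁻ʳ)
open import Data.Product using (Σ; _×_; _,_; proj₁; proj₂)
open import Function using (_∘_)
open import Relation.Binary.PropositionalEquality using (_≡_; refl; subst; sym)

module OneStep (𝕊 : Setting) where
  open Setting 𝕊
  open OneStepModel
  open Coalg

  SimulatesAt : ∀ {X Y : Set} → (X → Y → Set) → T X → T Y → Set₁
  SimulatesAt S t s =
    (∀ (p : Atom) → ⟦ p ⟧ₐ t → ⟦ p ⟧ₐ s) ×
    (∀ (♥ : Mod) A → ⟦ ♥ ⟧ₘ A t → ⟦ ♥ ⟧ₘ (image S A) s)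

  IsSimulation⇒simulatesAt : ∀ {C D : Coalg 𝕊} {S : St C → St D → Set} →
    IsSimulation 𝕊 C D S → ∀ {x y} → S x y → SimulatesAt S (ξ C x) (ξ D y)
  IsSimulation⇒simulatesAt (atoms , boxes) s = atoms _ _ s , boxes _ _ s

  simulatesAt⇒IsSimulation : ∀ {C D : Coalg 𝕊} {S : St C → St D → Set} →
    (∀ x y → S x y → SimulatesAt S (ξ C x) (ξ D y)) → IsSimulation 𝕊 C D S
  simulatesAt⇒IsSimulation local =
    (λ x y s → proj₁ (local x y s)) , (λ x y s → proj₂ (local x y s))

  simulatesAt-fmap⁺ : ∀ {X Y Z : Set} {S : Y → Z → Set} (f : X → Y) {t s} →
    SimulatesAt (S ∘ f) t s → SimulatesAt S (fmap f t) s
  simulatesAt-fmap⁺ f {t} {s} (atoms , boxes) =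
    (λ p h → atoms p (proj₂ (natₐ p f t) h)) ,
    (λ ♥ A h → monoₘ ♥ (λ z (x , Afx , r) → f x , Afx , r) s
                 (boxes ♥ (A ∘ f) (proj₂ (natₘ ♥ f A t) h)))

  simulatesAt-fmap⁻ : ∀ {X Y Z : Set} {S : Y → Z → Set} (f : X → Y) {t s} →
    SimulatesAt S (fmap f t) s → SimulatesAt (S ∘ f) t s
  simulatesAt-fmap⁻ {X} {Y} {S = S} f {t} {s} (atoms , boxes) =
    (λ p h → atoms p (proj₁ (natₐ p f t) h)) ,
    (λ ♥ A h → monoₘ ♥ pull s (boxes ♥ f[ A ] (push ♥ A h)))
    where
    f[_] : (X → Set) → Y → Set
    f[ A ] = image (λ x y → f x ≡ y) A

    push : ∀ ♥ A → ⟦ ♥ ⟧ₘ A t → ⟦ ♥ ⟧ₘ f[ A ] (fmap f t)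
    push ♥ A h = proj₁ (natₘ ♥ f f[ A ] t) (monoₘ ♥ (λ x Ax → x , Ax , refl) t h)

    pull : ∀ {A} z → image S f[ A ] z → image (S ∘ f) A z
    pull z (_ , (x , Ax , refl) , r) = x , Ax , r

  ⊨₁-transport : ∀ {V} {ψ : OneStepFormula 𝕊 V} (M N : OneStepModel 𝕊 V)
    {S : Car M → Car N → Set} → SimulatesAt S (pt M) (pt N) →
    (∀ v y → image S (τ M v) y → τ N v y) → _⊨₁_ 𝕊 M ψ → _⊨₁_ 𝕊 N ψ
  ⊨₁-transport M N (atoms , boxes) valuation = All.map λ {c} → transport c
    where
    transport : ∀ c → holds₁ 𝕊 M c → holds₁ 𝕊 N c
    transport (atom p)  h = atoms p h
    transport (box ♥ v) h = monoₘ ♥ (valuation v) (pt N) (boxes ♥ (τ M v) h)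

  conjSub⁺ : ∀ {k} {C : Set} {Q : C → Set} (f : Fin k → List C) (A : Subset k) →
    (∀ j → j ∈ A → All Q (f j)) → All Q (conjSub 𝕊 f A)
  conjSub⁺ f []          h = []
  conjSub⁺ f (true ∷ A)  h = ++⁺ (h zero here) (conjSub⁺ (f ∘ suc) A (λ j → h (suc j) ∘ there))
  conjSub⁺ f (false ∷ A) h = conjSub⁺ (f ∘ suc) A (λ j → h (suc j) ∘ there)

  conjSub⁻ : ∀ {k} {C : Set} {Q : C → Set} (f : Fin k → List C) (A : Subset k) →
    ∀ i → i ∈ A → All Q (conjSub 𝕊 f A) → All Q (f i)
  conjSub⁻ f (true ∷ A)  zero    here      h = ++⁻ˡ (f zero) h
  conjSub⁻ f (true ∷ A)  (suc i) (there p) h = conjSub⁻ (f ∘ suc) A i p (++⁻ʳ (f zero) h)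
  conjSub⁻ f (false ∷ A) (suc i) (there p) h = conjSub⁻ (f ∘ suc) A i p h

module Shallow (𝕊 : Setting) (W : WSIFamily 𝕊) {n : ℕ} (φs : ShallowBody 𝕊 n) where
  open WSIFamily W
  open Construction 𝕊 W φs
  open OneStep 𝕊
  open Coalg

  Var : Set
  Var = Fin (suc n)

  M[_] : Xφ → OneStepModel 𝕊 Var
  M[ a ] = osm (SubCar (Xψ (suc n) φ[ proj₁ a ])) (λ j b → j ∈ proj₁ b) (tψ (suc n) φ[ proj₁ a ])

  localModel : (D : Coalg 𝕊) → (Var → St D → Set) → St D → OneStepModel 𝕊 Var
  localModel D U z = osm (St D) U (ξ D z)

  IsPostFixpoint : (D : Coalg 𝕊) → (Var → St D → Set) → Set
  IsPostFixpoint D U = ∀ i z → U i z → _⊨₁_ 𝕊 (localModel D U z) (φs i)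

  member : Var → Xφ → Set
  member j a = j ∈ proj₁ a

  holdsAll : {D : Coalg 𝕊} → (Var → St D → Set) → Xφ → St D → Set
  holdsAll U a z = ∀ j → member j a → U j z

  postFixpoint⇒simulation : ∀ {D U} → IsPostFixpoint D U → IsSimulation 𝕊 Cφ D (holdsAll {D} U)
  postFixpoint⇒simulation {D} {U} post = simulatesAt⇒IsSimulation λ a z s →
    simulatesAt-fmap⁺ (incl a)
      (proj₂ (isWSI (suc n) φ[ proj₁ a ]) (localModel D U z)
        (conjSub⁺ φs (proj₁ a) λ j j∈a → post j z (s j j∈a)))

  simulation⇒postFixpoint : ∀ {D S} → IsSimulation 𝕊 Cφ D S →
    IsPostFixpoint D (λ j → image S (member j))
  simulation⇒postFixpoint {D} {S} sim i z (a , i∈a , s) =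
    conjSub⁻ φs (proj₁ a) i i∈a
      (⊨₁-transport M[ a ] (localModel D (λ j → image S (member j)) z)
        (simulatesAt-fmap⁻ (incl a) (IsSimulation⇒simulatesAt sim s))
        (λ j z′ (b , j∈b , r) → incl a b , j∈b , r)
        (proj₁ (isWSI (suc n) φ[ proj₁ a ])))

theorem6p5 : (𝕊 : Setting) → AdmitsOneStepWSI 𝕊 → (W : WSIFamily 𝕊) →
    (n : ℕ) → (φs : ShallowBody 𝕊 n) →
    IsWSI 𝕊 (Construction.Cφ 𝕊 W φs) (Construction.rφ 𝕊 W φs) φs
theorem6p5 𝕊 _ W n φs D y = sat⇒simulated , simulated⇒sat
  where
  open Shallow 𝕊 W φs
  open Construction 𝕊 W φs
  open Coalg

  Simulated : Set₁
  Simulated = Σ (Xφ → St D → Set) λ S → IsSimulation 𝕊 Cφ D S × S rφ y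

  sat⇒simulated : Sat 𝕊 D y φs → Simulated
  sat⇒simulated (U , post , U₀y) =
    holdsAll {D} U , postFixpoint⇒simulation post ,
    λ j j∈r → subst (λ k → U k y) (sym (x∈⁅y⁆⇒x≡y zero j∈r)) U₀y

  simulated⇒sat : Simulated → Sat 𝕊 D y φs
  simulated⇒sat (S , sim , rSy) =
    (λ j → image S (member j)) , simulation⇒postFixpoint sim , (rφ , x∈⁅x⁆ zero , rSy)
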